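{- Let $V$ be a finite ground set and let $f$ be a nonnegative ordered-submodular function defined on finite sequences of elements of $V$. Fix an integer $k \ge 1$ and let $A_k$ be the sequence of length $k$ produced by the greedy algorithm. Then $$f(A_k) \ge \tfrac{1}{2}\,\mathrm{OPT}(k), \qquad \text{where } \mathrm{OPT}(k) = \max\{ f(S) : S \text{ a sequence of } k \text{ elements of } V\}.$$
   Context: For sequences $A, B$, $A\|B$ denotes their concatenation, and for an element $s$, $A\|s$ denotes $A$ with $s$ appended at the end; $\emptyset$ is the empty sequence. A function $f$ on finite sequences of elements of $V$ is ordered-submodular if for all sequences $A$, $B$ and all elements $s, \bar s \in V$: $$f(A\|s) - f(A) \ge f(A\|s\|B) - f(A\|\bar s\|B).$$ The greedy algorithm: set $A_0 = \emptyset$; for $\ell = 1, \dots, k$, let $A_\ell = A_{\ell-1}\|a$ where $a \in V$ maximizes $f(A_{\ell-1}\|a)$ (ties broken arbitrarily).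
   Formalization: The function f takes rational values. -}

module Defs where

open import Data.Nat using (ℕ; suc) renaming (_≤_ to _≤ℕ_)
open import Data.Fin using (Fin)
open import Data.List using (List; []; _∷_; _++_; _∷ʳ_; take; length)
open import Data.Rational using (ℚ; 0ℚ; _-_; _≤_)
open import Relation.Binary.PropositionalEquality using (_≡_)
open import Data.Product using (_×_)

Seq : ℕ → Set
Seq n = List (Fin n)

Nonneg : ∀ {n} → (Seq n → ℚ) → Set
Nonneg f = ∀ S → 0ℚ ≤ f S

OrderedSubmodular : ∀ {n} → (Seq n → ℚ) → Set
OrderedSubmodular f =
  ∀ A B s s̄ → f ((A ∷ʳ s) ++ B) - f ((A ∷ʳ s̄) ++ B) ≤ f (A ∷ʳ s) - f A

-- A is a possible output of the greedy algorithm run for k steps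
-- (ties broken arbitrarily): |A| = k, and for every step ℓ = 1..k the appended
-- element maximizes f(A_{ℓ-1}‖a) over all a ∈ V, where A_ℓ = take ℓ A.
IsGreedyOutput : ∀ {n} → (Seq n → ℚ) → ℕ → Seq n → Set
IsGreedyOutput {n} f k A =
  length A ≡ k × (∀ ℓ → suc ℓ ≤ℕ k → (a : Fin n) → f (take ℓ A ∷ʳ a) ≤ f (take (suc ℓ) A))

{-# OPTIONS --safe #-}
-- A hybrid argument. Walk from the greedy output A towards S one position at a
-- time, replacing the i-th element of A by the i-th element of S. Ordered
-- submodularity bounds what such a replacement can change by the marginal gain
-- of putting S's element right after the greedy prefix, and that gain is at most
-- the greedy gain at step i. Summing over i, f S - f A ≤ f A - f [] ≤ f A.
module Submission where

open import Defs
open import Data.Nat using (ℕ; suc; s≤s) renaming (_≤_ to _≤ℕ_)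
open import Data.List using (List; []; _∷_; _++_; _∷ʳ_; take; length)
open import Data.List.Properties using (++-identityʳ; ∷ʳ-++; length-++-sucʳ; length-++-≤ˡ)
open import Data.Rational using (ℚ; ½; _*_; _≤_; _+_; _-_; 0ℚ)
open import Data.Rational.Properties using (+-monoˡ-≤; +-monoʳ-≤; +-identityʳ; ≤-refl; ≤-trans; *-monoˡ-≤-nonNeg; module ≤-Reasoning)
open import Data.Rational.Solver using (module +-*-Solver)
open import Relation.Binary.PropositionalEquality using (_≡_; refl; sym; trans; cong; subst; subst₂)
open import Data.Product using (_,_)
open import Data.Nat.Properties using (suc-injective)

open +-*-Solver

p-q≤r-s⇒p+s≤q+r : ∀ p q r s → p - q ≤ r - s → p + s ≤ q + r
p-q≤r-s⇒p+s≤q+r p q r s h = subst₂ _≤_ (lhs-eq p q s) (rhs-eq q r s) (+-monoˡ-≤ (q + s) h)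
  where
  lhs-eq : ∀ p q s → (p - q) + (q + s) ≡ p + s
  lhs-eq = solve 3 (λ p q s → (p :- q) :+ (q :+ s) := p :+ s) refl
  rhs-eq : ∀ q r s → (r - s) + (q + s) ≡ q + r
  rhs-eq = solve 3 (λ q r s → (r :- s) :+ (q :+ s) := q :+ r) refl

p+r≤q+q⇒½*p≤q : ∀ p q r → 0ℚ ≤ r → p + r ≤ q + q → ½ * p ≤ q
p+r≤q+q⇒½*p≤q p q r 0≤r p+r≤2q = begin
  ½ * p        ≤⟨ *-monoˡ-≤-nonNeg ½ (≤-trans p≤p+r p+r≤2q) ⟩
  ½ * (q + q)  ≡⟨ solve 1 (λ q → con ½ :* (q :+ q) := q) refl q ⟩
  q            ∎
  where
  open ≤-Reasoning
  p≤p+r : p ≤ p + r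
  p≤p+r = subst (_≤ p + r) (+-identityʳ p) (+-monoʳ-≤ p 0≤r)

module _ {A : Set} where

  take-length-++ : (xs ys : List A) → take (length xs) (xs ++ ys) ≡ xs
  take-length-++ []       ys = refl
  take-length-++ (x ∷ xs) ys = cong (x ∷_) (take-length-++ xs ys)

  take-suc-length-++ : (xs : List A) (y : A) (ys : List A) →
                       take (suc (length xs)) (xs ++ y ∷ ys) ≡ xs ∷ʳ y
  take-suc-length-++ []       y ys = refl
  take-suc-length-++ (x ∷ xs) y ys = cong (x ∷_) (take-suc-length-++ xs y ys)

  suc-length≤length-++-∷ : (xs : List A) (y : A) (ys : List A) →
                           suc (length xs) ≤ℕ length (xs ++ y ∷ ys)
  suc-length≤length-++-∷ xs y ys =
    subst (suc (length xs) ≤ℕ_) (sym (length-++-sucʳ xs y ys)) (s≤s (length-++-≤ˡ xs))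

module _ {n : ℕ} (f : Seq n → ℚ) where

  StepwiseGreedy : Seq n → Set
  StepwiseGreedy A = ∀ P a R → P ++ a ∷ R ≡ A → ∀ s → f (P ∷ʳ s) ≤ f (P ∷ʳ a)

  isGreedyOutput⇒stepwiseGreedy : ∀ {k A} → IsGreedyOutput f k A → StepwiseGreedy A
  isGreedyOutput⇒stepwiseGreedy (refl , greedy) P a R refl s =
    subst₂ _≤_ (cong (λ Q → f (Q ∷ʳ s)) (take-length-++ P (a ∷ R)))
               (cong f (take-suc-length-++ P a R))
               (greedy (length P) (suc-length≤length-++-∷ P a R) s)

  hybrid-bound : OrderedSubmodular f → ∀ {A} → StepwiseGreedy A →
                 ∀ P A' S' → P ++ A' ≡ A → length A' ≡ length S' →
                 f (P ++ S') + f P ≤ f (P ++ A') + f (P ++ A')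
  hybrid-bound submod greedy P [] [] _ _ rewrite ++-identityʳ P = ≤-refl
  hybrid-bound submod greedy P (a ∷ A') (s ∷ S') P++aA'≡A |aA'|≡|sS'| = begin
    f (P ++ s ∷ S') + f P              ≡⟨ cong (λ Q → f Q + f P) (sym (∷ʳ-++ P s S')) ⟩
    f (P ∷ʳ s ++ S') + f P             ≤⟨ p-q≤r-s⇒p+s≤q+r (f (P ∷ʳ s ++ S')) (f (P ∷ʳ a ++ S'))
                                             (f (P ∷ʳ s)) (f P) (submod P S' s a) ⟩
    f (P ∷ʳ a ++ S') + f (P ∷ʳ s)      ≤⟨ +-monoʳ-≤ (f (P ∷ʳ a ++ S')) (greedy P a A' P++aA'≡A s) ⟩
    f (P ∷ʳ a ++ S') + f (P ∷ʳ a)      ≤⟨ hybrid-bound submod greedy (P ∷ʳ a) A' S'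
                                             (trans (∷ʳ-++ P a A') P++aA'≡A) (suc-injective |aA'|≡|sS'|) ⟩
    f (P ∷ʳ a ++ A') + f (P ∷ʳ a ++ A') ≡⟨ cong (λ Q → f Q + f Q) (∷ʳ-++ P a A') ⟩
    f (P ++ a ∷ A') + f (P ++ a ∷ A')  ∎
    where open ≤-Reasoning

proposition1 : (n : ℕ) (f : Seq n → ℚ) → Nonneg f → OrderedSubmodular f →
    (k : ℕ) → 1 ≤ℕ k → (A : Seq n) → IsGreedyOutput f k A →
    (S : Seq n) → length S ≡ k → ½ * f S ≤ f A
proposition1 n f nonneg submod k _ A greedyA@(|A|≡k , _) S |S|≡k =
  p+r≤q+q⇒½*p≤q (f S) (f A) (f []) (nonneg [])
    (hybrid-bound f submod (isGreedyOutput⇒stepwiseGreedy f greedyA) [] A S refl (trans |A|≡k (sym |S|≡k)))
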